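{- Let $\pi$ be a program and $\Gamma,\Delta,\Pi,\Sigma$ finite sets of $\mathtt{TPDL}$ formulae. The sequent $\Gamma\vdash\Delta,\overleftarrow{[\pi]}\chi(\Pi\vdash\Sigma)$ is provable in $\mathtt{GTPDL}$ if and only if the sequent $\Pi\vdash\Sigma,[\pi]\chi(\Gamma\vdash\Delta)$ is provable in $\mathtt{GTPDL}$.
   Context: $\mathtt{TPDL}$ formulae/programs: $\varphi ::= \bot \mid p \mid (\varphi\to\varphi) \mid [\pi]\varphi \mid \overleftarrow{[\pi]}\varphi$, $\pi ::= \alpha \mid \pi;\pi \mid \pi\cup\pi \mid \pi^{*} \mid \varphi?$. Abbreviations: $\neg\varphi:=\varphi\to\bot$, $\varphi\lor\psi:=(\varphi\to\bot)\to\psi$, $\varphi\land\psi:=(\varphi\to(\psi\to\bot))\to\bot$. For a finite set $\Lambda=\{\varphi_0,\dots,\varphi_n\}$ (in a fixed enumeration), $\bigwedge\Lambda=(\cdots(\varphi_0\land\varphi_1)\land\cdots\land\varphi_n)$, $\bigvee\Lambda=(\cdots(\varphi_0\lor\varphi_1)\lor\cdots\lor\varphi_n)$, $\bigwedge\emptyset=\bot\to\bot$, $\bigvee\emptyset=\bot$. For a sequent, $\chi(\Gamma\vdash\Delta):=\bigwedge\Gamma\to\bigvee\Delta$. A sequent $\Gamma\vdash\Delta$ is a pair of finite sets; commas denote union; $H\Gamma=\{H\varphi:\varphi\in\Gamma\}$. Rules of $\mathtt{GTPDL}$ (premises $\Rightarrow$ conclusion): (Ax) $\Rightarrow\Gamma\vdash\Delta$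 if $\Gamma\cap\Delta\neq\emptyset$; ($\bot$) $\Rightarrow\Gamma,\bot\vdash\Delta$; ($\to$L) $\Gamma\vdash\varphi,\Delta$ and $\Gamma,\psi\vdash\Delta\Rightarrow\Gamma,\varphi\to\psi\vdash\Delta$; ($\to$R) $\Gamma,\varphi\vdash\psi,\Delta\Rightarrow\Gamma\vdash\varphi\to\psi,\Delta$; (Wk) $\Gamma\vdash\Delta\Rightarrow\Gamma'\vdash\Delta'$ for $\Gamma\subseteq\Gamma',\Delta\subseteq\Delta'$; (Cut) $\Gamma\vdash\varphi,\Delta$ and $\Gamma,\varphi\vdash\Delta\Rightarrow\Gamma\vdash\Delta$; ($[\,]$) $\Gamma\vdash\varphi,\overleftarrow{[\pi]}\Delta\Rightarrow[\pi]\Gamma\vdash[\pi]\varphi,\Delta$; ($\overleftarrow{[\,]}$) $\Gamma\vdash\varphi,[\pi]\Delta\Rightarrow\overleftarrow{[\pi]}\Gamma\vdash\overleftarrow{[\pi]}\varphi,\Delta$; ($[;]$L) $\Gamma,[\pi_0][\pi_1]\varphi\vdash\Delta\Rightarrow\Gamma,[\pi_0;\pi_1]\varphi\vdash\Delta$; ($[;]$R) $\Gamma\vdash[\pi_0][\pi_1]\varphi,\Delta\Rightarrow\Gamma\vdash[\pi_0;\pi_1]\varphi,\Delta$; ($[\cup]$L) $\Gamma,[\pi_0]\varphi,[\pi_1]\varphi\vdash\Delta\Rightarrow\Gamma,[\pi_0\cup\pi_1]\varphi\vdash\Delta$; ($[\cup]$R) $\Gamma\vdash\Delta,[\pi_0]\varphi$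 and $\Gamma\vdash\Delta,[\pi_1]\varphi\Rightarrow\Gamma\vdash[\pi_0\cup\pi_1]\varphi,\Delta$; ($[*]$L) $\Gamma,\varphi,[\pi][\pi^*]\varphi\vdash\Delta\Rightarrow\Gamma,[\pi^*]\varphi\vdash\Delta$; ($[*]$R) $\Gamma,\varphi\vdash[\pi]\varphi\Rightarrow[\pi^*]\Gamma,\varphi\vdash[\pi^*]\varphi$; ($[?]$L) $\Gamma\vdash\varphi,\Delta$ and $\Gamma,\psi\vdash\Delta\Rightarrow\Gamma,[\varphi?]\psi\vdash\Delta$; ($[?]$R) $\Gamma,\varphi\vdash\psi,\Delta\Rightarrow\Gamma\vdash[\varphi?]\psi,\Delta$. A proof is a finite tree of sequents each node of which is the conclusion of a rule instance whose premises are exactly its children; provable means being the root of a proof. -}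

module Defs where

open import Data.Nat using (ℕ)
open import Data.List using (List; []; _∷_; map; foldl)
open import Data.List.Membership.Propositional using (_∈_)
open import Data.List.Relation.Binary.Subset.Propositional using (_⊆_)

mutual
  data Fm : Set where
    ⊥'   : Fm
    var  : ℕ → Fm
    _⇒_  : Fm → Fm → Fm
    [_]_ : Prog → Fm → Fm
    ⟪_⟫_ : Prog → Fm → Fm          -- backward box  ←[π]φ

  data Prog : Set where
    atom : ℕ → Prog
    _⨾_  : Prog → Prog → Prog
    _∪'_ : Prog → Prog → Prog
    _*   : Prog → Prog
    _¿   : Fm → Prog

infixr 5 _⇒_

¬' : Fm → Fm
¬' φ = φ ⇒ ⊥'

_∨'_ : Fm → Fm → Fm
φ ∨' ψ = (φ ⇒ ⊥') ⇒ ψ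

_∧'_ : Fm → Fm → Fm
φ ∧' ψ = (φ ⇒ (ψ ⇒ ⊥')) ⇒ ⊥'

⋀ : List Fm → Fm
⋀ []      = ⊥' ⇒ ⊥'
⋀ (φ ∷ Λ) = foldl _∧'_ φ Λ

⋁ : List Fm → Fm
⋁ []      = ⊥'
⋁ (φ ∷ Λ) = foldl _∨'_ φ Λ

χ : List Fm → List Fm → Fm
χ Γ Δ = ⋀ Γ ⇒ ⋁ Δ

-- Provability in GTPDL. Sequent sides are lists read as finite sets:
-- "Γ, φ" is rendered φ ∷ Γ; set-equal lists are interchangeable via (Wk).
data ⊢G : List Fm → List Fm → Set where
  ax    : ∀ {Γ Δ φ} → φ ∈ Γ → φ ∈ Δ → ⊢G Γ Δ
  botL  : ∀ {Γ Δ} → ⊢G (⊥' ∷ Γ) Δ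
  impL  : ∀ {Γ Δ φ ψ} → ⊢G Γ (φ ∷ Δ) → ⊢G (ψ ∷ Γ) Δ → ⊢G ((φ ⇒ ψ) ∷ Γ) Δ
  impR  : ∀ {Γ Δ φ ψ} → ⊢G (φ ∷ Γ) (ψ ∷ Δ) → ⊢G Γ ((φ ⇒ ψ) ∷ Δ)
  wk    : ∀ {Γ Δ Γ' Δ'} → Γ ⊆ Γ' → Δ ⊆ Δ' → ⊢G Γ Δ → ⊢G Γ' Δ'
  cut   : ∀ {Γ Δ φ} → ⊢G Γ (φ ∷ Δ) → ⊢G (φ ∷ Γ) Δ → ⊢G Γ Δ
  box   : ∀ {Γ Δ φ π} → ⊢G Γ (φ ∷ map (⟪ π ⟫_) Δ) →
          ⊢G (map ([ π ]_) Γ) (([ π ] φ) ∷ Δ)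
  rbox  : ∀ {Γ Δ φ π} → ⊢G Γ (φ ∷ map ([ π ]_) Δ) →
          ⊢G (map (⟪ π ⟫_) Γ) ((⟪ π ⟫ φ) ∷ Δ)
  seqL  : ∀ {Γ Δ φ π₀ π₁} → ⊢G (([ π₀ ] ([ π₁ ] φ)) ∷ Γ) Δ → ⊢G (([ π₀ ⨾ π₁ ] φ) ∷ Γ) Δ
  seqR  : ∀ {Γ Δ φ π₀ π₁} → ⊢G Γ (([ π₀ ] ([ π₁ ] φ)) ∷ Δ) → ⊢G Γ (([ π₀ ⨾ π₁ ] φ) ∷ Δ)
  cupL  : ∀ {Γ Δ φ π₀ π₁} → ⊢G (([ π₀ ] φ) ∷ ([ π₁ ] φ) ∷ Γ) Δ → ⊢G (([ π₀ ∪' π₁ ] φ) ∷ Γ) Δ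
  cupR  : ∀ {Γ Δ φ π₀ π₁} → ⊢G Γ (([ π₀ ] φ) ∷ Δ) → ⊢G Γ (([ π₁ ] φ) ∷ Δ) →
          ⊢G Γ (([ π₀ ∪' π₁ ] φ) ∷ Δ)
  starL : ∀ {Γ Δ φ π} → ⊢G (φ ∷ ([ π ] ([ π * ] φ)) ∷ Γ) Δ → ⊢G (([ π * ] φ) ∷ Γ) Δ
  starR : ∀ {Γ φ π} → ⊢G (φ ∷ Γ) (([ π ] φ) ∷ []) →
          ⊢G (φ ∷ map ([ π * ]_) Γ) (([ π * ] φ) ∷ [])
  testL : ∀ {Γ Δ φ ψ} → ⊢G Γ (φ ∷ Δ) → ⊢G (ψ ∷ Γ) Δ → ⊢G (([ φ ¿ ] ψ) ∷ Γ) Δ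
  testR : ∀ {Γ Δ φ ψ} → ⊢G (φ ∷ Γ) (ψ ∷ Δ) → ⊢G Γ (([ φ ¿ ] ψ) ∷ Δ)

{-# OPTIONS --safe #-}
-- Γ ⊢ φ, Δ and ⊢ χ(Γ ⊢ Δ), φ are interderivable: cut the members of Γ against
-- ⋀Γ and the members of Δ against ⋁Δ.  With empty antecedent, ([ ]) turns
-- ⊢ φ, ←[π]ψ into ⊢ [π]φ, ψ and (←[ ]) turns it back, so [π] and ←[π] are
-- residuated; transporting this along the interderivability gives the theorem.
module Submission where

open import Defs
open import Data.List using (List; []; _∷_; _++_; foldl)
open import Data.List.Relation.Unary.Any using (here; there)
open import Data.List.Relation.Unary.Unique.Propositional using (Unique)
open import Data.List.Membership.Propositional using (_∈_)
open import Data.List.Membership.Propositional.Properties using (∈-++⁺ʳ)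
open import Data.List.Relation.Binary.Subset.Propositional using (_⊆_)
open import Data.List.Relation.Binary.Subset.Propositional.Properties
  using (⊆-refl; ⊆-reflexive-↭; xs⊆x∷xs; xs⊆xs++ys; ∈-∷⁺ʳ; ∷⁺ʳ)
open import Data.List.Relation.Binary.Permutation.Propositional using (_↭_; ↭-refl; ↭-sym; swap)
open import Data.List.Relation.Binary.Permutation.Propositional.Properties using (shift)
open import Function using (_∘_)
open import Function.Bundles using (_⇔_; mk⇔; Equivalence)
open import Relation.Binary.PropositionalEquality using (refl)

private variable
  φ ψ γ δ : Fm
  π : Prog
  Γ Δ Θ Ξ : List Fm

[_]⊆ : ∀ {x : Fm} {xs} → x ∈ xs → x ∷ [] ⊆ xs
[ x∈xs ]⊆ = ∈-∷⁺ʳ x∈xs (λ ())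

exchange : Γ ↭ Θ → Δ ↭ Ξ → ⊢G Γ Δ → ⊢G Θ Ξ
exchange Γ↭Θ Δ↭Ξ = wk (⊆-reflexive-↭ Γ↭Θ) (⊆-reflexive-↭ Δ↭Ξ)

⊢-trans : ⊢G (φ ∷ []) (ψ ∷ []) → ⊢G (ψ ∷ []) Ξ → ⊢G (φ ∷ []) Ξ
⊢-trans d e = cut (wk ⊆-refl [ here refl ]⊆ d) (wk [ here refl ]⊆ ⊆-refl e)

cut-antecedents : ∀ Γ → (∀ {γ} → γ ∈ Γ → ⊢G Θ (γ ∷ Ξ)) → ⊢G (Γ ++ Θ) Ξ → ⊢G Θ Ξ
cut-antecedents []      _ d = d
cut-antecedents (γ ∷ Γ) h d = cut (h (here refl)) (cut-antecedents Γ
  (λ γ∈Γ → wk (xs⊆x∷xs _ γ) ⊆-refl (h (there γ∈Γ)))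
  (exchange (↭-sym (shift γ Γ _)) ↭-refl d))

cut-succedents : ∀ Δ → (∀ {δ} → δ ∈ Δ → ⊢G (δ ∷ Θ) Ξ) → ⊢G Θ (Δ ++ Ξ) → ⊢G Θ Ξ
cut-succedents []      _ d = d
cut-succedents (δ ∷ Δ) h d = cut (cut-succedents Δ
  (λ δ∈Δ → wk ⊆-refl (xs⊆x∷xs _ δ) (h (there δ∈Δ)))
  (exchange ↭-refl (↭-sym (shift δ Δ _)) d)) (h (here refl))

∧'-intro : ⊢G Θ (φ ∷ []) → ⊢G Θ (ψ ∷ []) → ⊢G Θ ((φ ∧' ψ) ∷ [])
∧'-intro d e = impR (impL (wk ⊆-refl [ here refl ]⊆ d) (impL (wk ⊆-refl [ here refl ]⊆ e) botL))

∧'-elimˡ : ⊢G ((φ ∧' ψ) ∷ []) (φ ∷ [])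
∧'-elimˡ = impL (impR (ax (here refl) (there (here refl)))) botL

∧'-elimʳ : ⊢G ((φ ∧' ψ) ∷ []) (ψ ∷ [])
∧'-elimʳ = impL (impR (impR (ax (here refl) (there (here refl))))) botL

∨'-introˡ : ⊢G (φ ∷ []) ((φ ∨' ψ) ∷ [])
∨'-introˡ = impR (impL (ax (here refl) (here refl)) botL)

∨'-introʳ : ⊢G (ψ ∷ []) ((φ ∨' ψ) ∷ [])
∨'-introʳ = impR (ax (there (here refl)) (here refl))

∨'-elim : ⊢G ((φ ∨' ψ) ∷ []) (φ ∷ ψ ∷ [])
∨'-elim = impL (impR (ax (here refl) (there (here refl)))) (ax (here refl) (there (here refl)))

foldl-∧'-intro : ∀ φ Λ → ⊢G Θ (φ ∷ []) → Λ ⊆ Θ → ⊢G Θ (foldl _∧'_ φ Λ ∷ [])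
foldl-∧'-intro φ []      d _    = d
foldl-∧'-intro φ (ψ ∷ Λ) d ψΛ⊆Θ =
  foldl-∧'-intro (φ ∧' ψ) Λ (∧'-intro d (ax (ψΛ⊆Θ (here refl)) (here refl))) (ψΛ⊆Θ ∘ there)

foldl-∧'-elim : ∀ φ Λ → γ ∈ φ ∷ Λ → ⊢G (foldl _∧'_ φ Λ ∷ []) (γ ∷ [])
foldl-∧'-elim φ []      (here refl)         = ax (here refl) (here refl)
foldl-∧'-elim φ (ψ ∷ Λ) (here refl)         = ⊢-trans (foldl-∧'-elim (φ ∧' ψ) Λ (here refl)) ∧'-elimˡ
foldl-∧'-elim φ (ψ ∷ Λ) (there (here refl)) = ⊢-trans (foldl-∧'-elim (φ ∧' ψ) Λ (here refl)) ∧'-elimʳ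
foldl-∧'-elim φ (ψ ∷ Λ) (there (there γ∈Λ)) = foldl-∧'-elim (φ ∧' ψ) Λ (there γ∈Λ)

foldl-∨'-intro : ∀ φ Λ → δ ∈ φ ∷ Λ → ⊢G (δ ∷ []) (foldl _∨'_ φ Λ ∷ [])
foldl-∨'-intro φ []      (here refl)         = ax (here refl) (here refl)
foldl-∨'-intro φ (ψ ∷ Λ) (here refl)         = ⊢-trans ∨'-introˡ (foldl-∨'-intro (φ ∨' ψ) Λ (here refl))
foldl-∨'-intro φ (ψ ∷ Λ) (there (here refl)) = ⊢-trans ∨'-introʳ (foldl-∨'-intro (φ ∨' ψ) Λ (here refl))
foldl-∨'-intro φ (ψ ∷ Λ) (there (there δ∈Λ)) = foldl-∨'-intro (φ ∨' ψ) Λ (there δ∈Λ)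

foldl-∨'-elim : ∀ φ Λ → ⊢G (foldl _∨'_ φ Λ ∷ []) (φ ∷ Λ)
foldl-∨'-elim φ []      = ax (here refl) (here refl)
foldl-∨'-elim φ (ψ ∷ Λ) = cut
  (wk ⊆-refl (∷⁺ʳ _ (xs⊆x∷xs _ φ ∘ xs⊆x∷xs _ ψ)) (foldl-∨'-elim (φ ∨' ψ) Λ))
  (wk [ here refl ]⊆ (xs⊆xs++ys (φ ∷ ψ ∷ []) Λ) ∨'-elim)

⋀-intro : ∀ Γ → ⊢G Γ (⋀ Γ ∷ [])
⋀-intro []      = impR botL
⋀-intro (φ ∷ Γ) = foldl-∧'-intro φ Γ (ax (here refl) (here refl)) there

⋀-elim : ∀ Γ → γ ∈ Γ → ⊢G (⋀ Γ ∷ []) (γ ∷ [])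
⋀-elim (φ ∷ Γ) = foldl-∧'-elim φ Γ

⋁-intro : ∀ Δ → δ ∈ Δ → ⊢G (δ ∷ []) (⋁ Δ ∷ [])
⋁-intro (φ ∷ Δ) = foldl-∨'-intro φ Δ

⋁-elim : ∀ Δ → ⊢G (⋁ Δ ∷ []) Δ
⋁-elim []      = botL
⋁-elim (φ ∷ Δ) = foldl-∨'-elim φ Δ

χ-intro : ∀ Γ Δ → ⊢G Γ (φ ∷ Δ) → ⊢G [] (χ Γ Δ ∷ φ ∷ [])
χ-intro {φ} Γ Δ d = impR (cut-antecedents Γ
  (λ γ∈Γ → wk ⊆-refl [ here refl ]⊆ (⋀-elim Γ γ∈Γ))
  (cut-succedents Δ
    (λ δ∈Δ → wk [ here refl ]⊆ (xs⊆xs++ys (⋁ Δ ∷ []) (φ ∷ [])) (⋁-intro Δ δ∈Δ))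
    (wk (xs⊆xs++ys Γ _) (∈-∷⁺ʳ (∈-++⁺ʳ Δ (there (here refl))) (xs⊆xs++ys Δ _)) d)))

χ-elim : ∀ Γ Δ → ⊢G [] (χ Γ Δ ∷ φ ∷ []) → ⊢G Γ (φ ∷ Δ)
χ-elim {φ} Γ Δ d = cut
  (wk (λ ()) (xs⊆xs++ys (χ Γ Δ ∷ φ ∷ []) Δ) d)
  (impL (wk ⊆-refl [ here refl ]⊆ (⋀-intro Γ)) (wk [ here refl ]⊆ (xs⊆x∷xs Δ φ) (⋁-elim Δ)))

χ-internalise : ∀ Γ Δ → ⊢G Γ (φ ∷ Δ) ⇔ ⊢G [] (χ Γ Δ ∷ φ ∷ [])
χ-internalise Γ Δ = mk⇔ (χ-intro Γ Δ) (χ-elim Γ Δ)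

[]-transpose : ⊢G [] (φ ∷ ⟪ π ⟫ ψ ∷ []) → ⊢G [] (ψ ∷ [ π ] φ ∷ [])
[]-transpose {ψ = ψ} d = exchange ↭-refl (swap _ _ ↭-refl) (box {Γ = []} {Δ = ψ ∷ []} d)

⟪⟫-transpose : ⊢G [] (φ ∷ [ π ] ψ ∷ []) → ⊢G [] (ψ ∷ ⟪ π ⟫ φ ∷ [])
⟪⟫-transpose {ψ = ψ} d = exchange ↭-refl (swap _ _ ↭-refl) (rbox {Γ = []} {Δ = ψ ∷ []} d)

mainTheorem6 : (π : Prog) (Γ Δ Π Σ : List Fm) →
    Unique Γ → Unique Δ → Unique Π → Unique Σ →
    ⊢G Γ ((⟪ π ⟫ χ Π Σ) ∷ Δ) ⇔ ⊢G Π (([ π ] χ Γ Δ) ∷ Σ)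
mainTheorem6 π Γ Δ Π Σ _ _ _ _ = mk⇔
  (from (χ-internalise Π Σ) ∘ []-transpose ∘ to (χ-internalise Γ Δ))
  (from (χ-internalise Γ Δ) ∘ ⟪⟫-transpose ∘ to (χ-internalise Π Σ))
  where open Equivalence
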